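{- Let $(S,\curlyvee)$ be a $\curlyvee$-algebra. For all $a,b,c,d,i\in S$, if $d\lesssim a\sqcup i$, $d\lesssim b\sqcup i$, $d\lesssim c\sqcup i$, $d\lesssim(a\curlyvee b)\sqcup i$ and $d\lesssim(b\curlyvee c)\sqcup i$, then $d\lesssim(a\curlyvee c)\sqcup i$.
   Context: A $\curlyvee$-algebra is an algebra $(S,\curlyvee)$ with a binary operation such that, setting $a\sqcup b=a\curlyvee(a\curlyvee b)$: $(S,\sqcup)$ is a left regular band (associative, $a\sqcup a=a$, $a\sqcup b\sqcup a=a\sqcup b$); $\curlyvee$ is commutative and idempotent; $(a\curlyvee b)\sqcup(a\sqcup b)=a\sqcup b$; $a\sqcup(b\curlyvee c)=(a\sqcup b)\curlyvee(a\sqcup c)$; and, writing $x\lesssim y$ iff $y\sqcup x=y$: if $d\lesssim a,b,c,a\curlyvee b,b\curlyvee c$ then $d\lesssim a\curlyvee c$. -}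

module Defs where

open import Level using (Level; suc)
open import Relation.Binary.PropositionalEquality using (_≡_)

record VeeAlgebra (ℓ : Level) : Set (suc ℓ) where
  infixl 6 _⋎_
  infixl 5 _⊔_
  infix 4 _≲_
  field
    S   : Set ℓ
    _⋎_ : S → S → S

  _⊔_ : S → S → S
  a ⊔ b = a ⋎ (a ⋎ b)

  _≲_ : S → S → Set ℓ
  x ≲ y = y ⊔ x ≡ y

  field
    ⊔-assoc : ∀ a b c → (a ⊔ b) ⊔ c ≡ a ⊔ (b ⊔ c)
    ⊔-idem  : ∀ a → a ⊔ a ≡ a
    ⊔-lrb   : ∀ a b → a ⊔ b ⊔ a ≡ a ⊔ b
    ⋎-comm  : ∀ a b → a ⋎ b ≡ b ⋎ a
    ⋎-idem  : ∀ a → a ⋎ a ≡ a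
    ⋎-⊔-absorb : ∀ a b → (a ⋎ b) ⊔ (a ⊔ b) ≡ a ⊔ b
    ⊔-distrib-⋎ : ∀ a b c → a ⊔ (b ⋎ c) ≡ (a ⊔ b) ⋎ (a ⊔ c)
    ≲-⋎-trans : ∀ a b c d → d ≲ a → d ≲ b → d ≲ c → d ≲ a ⋎ b → d ≲ b ⋎ c
                → d ≲ a ⋎ c

{-# OPTIONS --safe #-}
module Submission where

-- In a left regular band x ⊔ y ≲ y ⊔ x, so every hypothesis d ≲ x ⊔ i may be read as
-- d ≲ i ⊔ x and the conclusion recovered from d ≲ i ⊔ (a ⋎ c). Since i ⊔ _ distributes
-- over ⋎, the latter is the ⋎-transitivity axiom applied to i ⊔ a, i ⊔ b, i ⊔ c.

open import Defs
open import Level using (Level)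
open import Relation.Binary.PropositionalEquality

module VeeAlgebraProperties {ℓ : Level} (V : VeeAlgebra ℓ) where
  open VeeAlgebra V
  open ≡-Reasoning

  ≲-trans : ∀ {x y z} → x ≲ y → y ≲ z → x ≲ z
  ≲-trans {x} {y} {z} x≲y y≲z = begin
    z ⊔ x        ≡⟨ cong (_⊔ x) (sym y≲z) ⟩
    z ⊔ y ⊔ x    ≡⟨ ⊔-assoc z y x ⟩
    z ⊔ (y ⊔ x)  ≡⟨ cong (z ⊔_) x≲y ⟩
    z ⊔ y        ≡⟨ y≲z ⟩
    z            ∎

  ⊔-comm-≲ : ∀ x y → x ⊔ y ≲ y ⊔ x
  ⊔-comm-≲ x y = begin
    y ⊔ x ⊔ (x ⊔ y)  ≡⟨ sym (⊔-assoc (y ⊔ x) x y) ⟩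
    y ⊔ x ⊔ x ⊔ y    ≡⟨ cong (_⊔ y) (⊔-assoc y x x) ⟩
    y ⊔ (x ⊔ x) ⊔ y  ≡⟨ cong (λ t → y ⊔ t ⊔ y) (⊔-idem x) ⟩
    y ⊔ x ⊔ y        ≡⟨ ⊔-lrb y x ⟩
    y ⊔ x            ∎

  ≲-⊔-swap : ∀ {d} x y → d ≲ x ⊔ y → d ≲ y ⊔ x
  ≲-⊔-swap x y d≲xy = ≲-trans d≲xy (⊔-comm-≲ x y)

  ≲-⊔ˡ-⋎-trans : ∀ i a b c d → d ≲ i ⊔ a → d ≲ i ⊔ b → d ≲ i ⊔ c
                 → d ≲ i ⊔ (a ⋎ b) → d ≲ i ⊔ (b ⋎ c) → d ≲ i ⊔ (a ⋎ c)
  ≲-⊔ˡ-⋎-trans i a b c d d≲ia d≲ib d≲ic d≲iab d≲ibc =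
    subst (d ≲_) (sym (⊔-distrib-⋎ i a c))
      (≲-⋎-trans (i ⊔ a) (i ⊔ b) (i ⊔ c) d d≲ia d≲ib d≲ic
        (subst (d ≲_) (⊔-distrib-⋎ i a b) d≲iab)
        (subst (d ≲_) (⊔-distrib-⋎ i b c) d≲ibc))

lemma4p4 : ∀ {ℓ : Level} (V : VeeAlgebra ℓ) → let open VeeAlgebra V in
           ∀ a b c d i → d ≲ a ⊔ i → d ≲ b ⊔ i → d ≲ c ⊔ i
           → d ≲ (a ⋎ b) ⊔ i → d ≲ (b ⋎ c) ⊔ i → d ≲ (a ⋎ c) ⊔ i
lemma4p4 V a b c d i d≲ai d≲bi d≲ci d≲abi d≲bci =
  ≲-⊔-swap i (a ⋎ c)
    (≲-⊔ˡ-⋎-trans i a b c d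
      (≲-⊔-swap a i d≲ai) (≲-⊔-swap b i d≲bi) (≲-⊔-swap c i d≲ci)
      (≲-⊔-swap (a ⋎ b) i d≲abi) (≲-⊔-swap (b ⋎ c) i d≲bci))
  where
  open VeeAlgebra V
  open VeeAlgebraProperties V
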